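{- Let $((i_1\,j_1),\ldots,(i_k\,j_k))\in(\mathsf T_n)^k$ with $i_1\leq\cdots\leq i_k$. The following are equivalent: 1. $((i_1\,j_1),\ldots,(i_k\,j_k))\in\Sigma_n(k)$; 2. for all $l,m\in\{1,\ldots,k\}$ with $l<m$, either $j_l\leq i_m$ or $j_l>j_m$.
   Context: Permutations are multiplied with the right factor applied first. $\mathsf T_n$ is the set of transpositions of $\{1,\ldots,n\}$; a transposition is written $(i\,j)$ with $i<j$. For $\sigma\in\mathfrak S_n$, $|\sigma|=n-(\text{number of cycles of }\sigma\text{, fixed points included})$, and $\sigma_1\preccurlyeq\sigma_2$ iff $|\sigma_2|=|\sigma_1|+|\sigma_1^{ -1}\sigma_2|$. $\Sigma_n(k)=\{(\tau_1,\ldots,\tau_k)\in(\mathsf T_n)^k : |\tau_1\cdots\tau_k|=k,\ \tau_1\cdots\tau_k\preccurlyeq(1\,2\,\cdots\,n)\}$. -}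

module Defs where

open import Data.Nat using (ℕ; zero; suc; _+_; _∸_)
open import Data.Fin using (Fin; toℕ; _<_; _≤_) renaming (zero to 0F; suc to sucF)
open import Data.Fin.Properties using (all?)
import Data.Nat.Properties as ℕP
open import Data.Fin.Permutation using (Permutation′; transpose; lift₀; id; flip; _∘ₚ_; _⟨$⟩ʳ_)
import Data.List
open import Data.List using (List; length; filter; _∷_; [])
open import Data.List.Base using (allFin)
open import Data.Product using (_,_; _×_)
open import Relation.Unary using (Decidable)
open import Relation.Binary.PropositionalEquality using (_≡_; refl)

-- Product of permutations, RIGHT factor applied first:  (σ · τ) x = σ (τ x).
-- (stdlib's _∘ₚ_ is diagrammatic: (π₁ ∘ₚ π₂) applies π₁ first.)
infixl 7 _·_
_·_ : ∀ {n} → Permutation′ n → Permutation′ n → Permutation′ n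
σ · τ = τ ∘ₚ σ

_⁻¹ : ∀ {n} → Permutation′ n → Permutation′ n
σ ⁻¹ = flip σ

iter : ∀ {n} → (Fin n → Fin n) → ℕ → Fin n → Fin n
iter f zero    x = x
iter f (suc t) x = f (iter f t x)

-- x is the smallest element of its cycle (orbit) under σ.
-- The orbit of x under a permutation of Fin n is {σ^t x | 0 ≤ t < n}.
IsCycleMin : ∀ {n} → Permutation′ n → Fin n → Set
IsCycleMin {n} σ x = ∀ (t : Fin n) → x ≤ iter (σ ⟨$⟩ʳ_) (toℕ t) x

isCycleMin? : ∀ {n} (σ : Permutation′ n) → Decidable (IsCycleMin σ)
isCycleMin? σ x = all? (λ t → toℕ x ℕP.≤? toℕ (iter (σ ⟨$⟩ʳ_) (toℕ t) x))

numCycles : ∀ {n} → Permutation′ n → ℕ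
numCycles {n} σ = length (filter (isCycleMin? σ) (allFin n))

∣_∣ₚ : ∀ {n} → Permutation′ n → ℕ
∣_∣ₚ {n} σ = n ∸ numCycles σ

_≼_ : ∀ {n} → Permutation′ n → Permutation′ n → Set
σ₁ ≼ σ₂ = ∣ σ₂ ∣ₚ ≡ ∣ σ₁ ∣ₚ + ∣ σ₁ ⁻¹ · σ₂ ∣ₚ

-- The long cycle (1 2 ⋯ n), i.e. (in 0-based Fin n) x ↦ x+1 mod n.
-- Defined recursively via (1 2 ⋯ n) = (1 2) · (2 3 ⋯ n).
longCycle : ∀ n → Permutation′ n
longCycle zero = id
longCycle (suc zero) = id
longCycle (suc (suc m)) = transpose 0F (sucF 0F) · lift₀ (longCycle (suc m))

private
  lc-test : Data.List.map (λ x → toℕ (longCycle 4 ⟨$⟩ʳ x)) (allFin 4)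
            ≡ 1 ∷ 2 ∷ 3 ∷ 0 ∷ []
  lc-test = refl

-- A transposition (i j) of {1,…,n}, with i < j (0-based in Fin n).
record Transposition (n : ℕ) : Set where
  constructor ⟨_,_∣_⟩
  field
    i  : Fin n
    j  : Fin n
    i<j : i < j

open Transposition public

toPerm : ∀ {n} → Transposition n → Permutation′ n
toPerm τ = transpose (i τ) (j τ)

prod : ∀ {n k} → (Fin k → Transposition n) → Permutation′ n
prod {k = zero}  τ = id
prod {k = suc k} τ = toPerm (τ 0F) · prod (λ l → τ (sucF l))

InΣ : ∀ n k → (Fin k → Transposition n) → Set
InΣ n k τ = (∣ prod τ ∣ₚ ≡ k) × (prod τ ≼ longCycle n)

private
  nc-test₁ : numCycles (longCycle 5) ≡ 1
  nc-test₁ = refl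
  nc-test₂ : numCycles (id {4}) ≡ 4
  nc-test₂ = refl
  nc-test₃ : ∣ transpose {5} 0F (sucF (sucF 0F)) · longCycle 5 ∣ₚ ≡ 3
  nc-test₃ = refl

-- Everything rests on one fact about cycle counts: left multiplication
-- by a transposition (a b) splits the cycle through a and b into two
-- when a, b share a cycle, and joins their cycles otherwise.
-- Then, writing c = (1 2 ⋯ n), membership in Σₙ(k) amounts to two counts:
-- prod τ has n - k cycles and (prod τ)⁻¹ · c = τₖ ⋯ τ₁ c has k + 1.
--   • Non-crossing ⇒ each τₗ joins two cycles of τₗ₊₁ ⋯ τₖ (the interval
--     [iₗ, jₗ) is a union of their cycles), and each τₗ splits a cycle of
--     τₗ₋₁ ⋯ τ₁ c (these still shift every later interval by one step).
--   • Conversely, k + 1 cycles means every step splits; the first τₘ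
--     crossing τ₁ would instead join two cycles across [i₁, j₁).

module Submission where

open import Defs
open import Data.Nat as ℕ using (ℕ; zero; suc; _+_; _∸_; _*_; z≤n; s≤s; z<s; s<s)
import Data.Nat.Properties as ℕₚ
open import Data.Nat.Induction using (<-wellFounded)
open import Data.Nat.DivMod using (_%_; _/_; m≡m%n+[m/n]*n; m%n<n)
open import Data.Fin using (Fin; toℕ; fromℕ<; _<_; _≤_) renaming (zero to 0F; suc to sucF)
import Data.Fin.Induction as Finᵢ
import Data.Fin.Properties as Finₚ
open import Data.Fin.Permutation using (Permutation′; id; transpose; _⟨$⟩ʳ_; _⟨$⟩ˡ_; inverseˡ)
import Data.Fin.Permutation.Components as PC
open import Data.Bool using (Bool; true; false)
open import Data.List using (length; filter; tabulate)
open import Data.Vec.Functional using (head; tail)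
open import Data.Product using (Σ; _×_; _,_; proj₁; proj₂)
open import Data.Sum using (_⊎_; inj₁; inj₂) renaming (map to map⊎)
open import Data.Empty using (⊥; ⊥-elim)
open import Function using (_∘_)
open import Function.Bundles using (_⇔_; mk⇔; module Equivalence)
open import Induction.WellFounded using (Acc; acc)
open import Relation.Nullary using (¬_; ¬?; Dec; yes; no; does)
open import Relation.Nullary.Decidable using (map′; _×-dec_; _⊎-dec_; _→-dec_; dec-true; dec-false; does-⇔; decidable-stable)
open import Relation.Unary using (Decidable)
open import Relation.Binary.PropositionalEquality

indicator : Bool → ℕ
indicator true  = 1
indicator false = 0

count : ∀ {n} → (Fin n → Bool) → ℕ
count {zero}  p = 0
count {suc n} p = indicator (p 0F) + count (p ∘ sucF)

length-filter-tabulate : ∀ {m n} {P : Fin m → Set} (P? : Decidable P) (h : Fin n → Fin m) →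
  length (filter P? (tabulate h)) ≡ count (λ x → does (P? (h x)))
length-filter-tabulate {n = zero}  P? h = refl
length-filter-tabulate {n = suc n} P? h with does (P? (h 0F))
... | true  = cong suc (length-filter-tabulate P? (h ∘ sucF))
... | false = length-filter-tabulate P? (h ∘ sucF)

count-cong : ∀ {n} {p q : Fin n → Bool} → (∀ x → p x ≡ q x) → count p ≡ count q
count-cong {zero}  e = refl
count-cong {suc n} e = cong₂ _+_ (cong indicator (e 0F)) (count-cong (e ∘ sucF))

count-≤ : ∀ {n} (p : Fin n → Bool) → count p ℕ.≤ n
count-≤ {zero}  p = z≤n
count-≤ {suc n} p with p 0F
... | true  = s≤s (count-≤ (p ∘ sucF))
... | false = ℕₚ.m≤n⇒m≤1+n (count-≤ (p ∘ sucF))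

count-all : ∀ {n} {p : Fin n → Bool} → (∀ x → p x ≡ true) → count p ≡ n
count-all {zero}  e = refl
count-all {suc n} e rewrite e 0F = cong suc (count-all (e ∘ sucF))

count-none : ∀ {n} {p : Fin n → Bool} → (∀ x → p x ≡ false) → count p ≡ 0
count-none {zero}  e = refl
count-none {suc n} e rewrite e 0F = count-none (e ∘ sucF)

count-pos : ∀ {n} (p : Fin (suc n) → Bool) → p 0F ≡ true → 1 ℕ.≤ count p
count-pos p e rewrite e = s≤s z≤n

count-only-zero : ∀ {n} (p : Fin (suc n) → Bool) →
  p 0F ≡ true → (∀ x → p (sucF x) ≡ false) → count p ≡ 1
count-only-zero p e0 e rewrite e0 = cong suc (count-none e)

count-drop : ∀ {n} {p q : Fin n → Bool} (e : Fin n) → (∀ x → x ≢ e → p x ≡ q x) →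
  p e ≡ true → q e ≡ false → count p ≡ suc (count q)
count-drop 0F agree pe qe rewrite pe | qe =
  cong suc (count-cong (λ x → agree (sucF x) λ ()))
count-drop {q = q} (sucF e) agree pe qe rewrite agree 0F (λ ()) =
  trans (cong (indicator (q 0F) +_) ih) (ℕₚ.+-suc (indicator (q 0F)) _)
  where
  ih = count-drop e (λ x x≢e → agree (sucF x) (x≢e ∘ Finₚ.suc-injective)) pe qe

least-witness : ∀ {Q : ℕ → Set} → Decidable Q → ∀ w → Q w →
  Σ ℕ λ r → Q r × (∀ t → t ℕ.< r → ¬ Q t)
least-witness {Q} Q? w qw = descend w qw (<-wellFounded w)
  where
  descend : ∀ w → Q w → Acc ℕ._<_ w → Σ ℕ λ r → Q r × (∀ t → t ℕ.< r → ¬ Q t)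
  descend w qw (acc below) with ℕₚ.anyUpTo? Q? w
  ... | yes (t , t<w , qt) = descend t qt (below t<w)
  ... | no none = w , qw , λ t t<w qt → none (t , t<w , qt)

minimum : ∀ {n} {P : Fin n → Set} → Decidable P → ∀ {x} → P x →
  Σ (Fin n) λ m → P m × (∀ y → P y → m ≤ y)
minimum {n} {P} P? {x} px = descend x px (Finᵢ.<-wellFounded x)
  where
  descend : ∀ x → P x → Acc _<_ x → Σ (Fin n) λ m → P m × (∀ y → P y → m ≤ y)
  descend x px (acc below) with Finₚ.any? (λ y → (y Finₚ.<? x) ×-dec P? y)
  ... | yes (y , y<x , py) = descend y py (below y<x)
  ... | no none = x , px , λ y py → ℕₚ.≮⇒≥ (λ y<x → none (y , y<x , py))

-- Cycles of a permutation.  The orbit relation is decidable because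
-- every orbit is reached within n steps (pigeonhole), and the cycle
-- count of Defs counts the orbit-minima.

iter-+ : ∀ {n} (f : Fin n → Fin n) a b x → iter f (a + b) x ≡ iter f a (iter f b x)
iter-+ f zero    b x = refl
iter-+ f (suc a) b x = cong f (iter-+ f a b x)

iter-cong : ∀ {n} {f g : Fin n → Fin n} → (∀ x → f x ≡ g x) → ∀ t x → iter f t x ≡ iter g t x
iter-cong e zero    x = refl
iter-cong {f = f} e (suc t) x = trans (cong f (iter-cong e t x)) (e _)

IsLeast : ∀ {n} → (Fin n → Fin n → Set) → Fin n → Set
IsLeast R x = ∀ y → R x y → x ≤ y

isLeast? : ∀ {n} {R : Fin n → Fin n → Set} → (∀ x y → Dec (R x y)) → Decidable (IsLeast R)
isLeast? R? x = Finₚ.all? (λ y → R? x y →-dec (x Finₚ.≤? y))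

classCount : ∀ {n} {R : Fin n → Fin n → Set} → (∀ x y → Dec (R x y)) → ℕ
classCount R? = count (λ x → does (isLeast? R? x))

module _ {n : ℕ} (π : Permutation′ n) where
  private
    f : Fin n → Fin n
    f = π ⟨$⟩ʳ_

  SameCycle : Fin n → Fin n → Set
  SameCycle x y = Σ ℕ λ t → iter f t x ≡ y

  iter-injective : ∀ t {x y} → iter f t x ≡ iter f t y → x ≡ y
  iter-injective zero    e = e
  iter-injective (suc t) e =
    iter-injective t (trans (sym (inverseˡ π)) (trans (cong (π ⟨$⟩ˡ_) e) (inverseˡ π)))

  period : ∀ x → Σ ℕ λ p → suc p ℕ.≤ n × iter f (suc p) x ≡ x
  period x with Finₚ.pigeonhole (ℕₚ.n<1+n n) (λ (t : Fin (suc n)) → iter f (toℕ t) x)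
  ... | s , t , s<t , coincide = p , bound , iter-injective (toℕ s) returns
    where
    p = toℕ t ∸ suc (toℕ s)
    t≡s+p : toℕ t ≡ toℕ s + suc p
    t≡s+p = trans (sym (ℕₚ.m∸n+n≡m s<t))
              (trans (ℕₚ.+-comm p (suc (toℕ s))) (sym (ℕₚ.+-suc (toℕ s) p)))
    returns : iter f (toℕ s) (iter f (suc p) x) ≡ iter f (toℕ s) x
    returns = trans (sym (iter-+ f (toℕ s) (suc p) x))
                (trans (cong (λ u → iter f u x) (sym t≡s+p)) (sym coincide))
    bound : suc p ℕ.≤ n
    bound = ℕₚ.≤-trans (ℕₚ.m≤n+m (suc p) (toℕ s))
              (ℕₚ.≤-trans (ℕₚ.≤-reflexive (sym t≡s+p)) (ℕ.s≤s⁻¹ (Finₚ.toℕ<n t)))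

  iter-periodic : ∀ P x → iter f P x ≡ x → ∀ q → iter f (q * P) x ≡ x
  iter-periodic P x e zero    = refl
  iter-periodic P x e (suc q) =
    trans (iter-+ f P (q * P) x) (trans (cong (iter f P) (iter-periodic P x e q)) e)

  -- reducing the number of steps modulo the period
  sameCycle-bounded : ∀ {x y} → SameCycle x y → Σ (Fin n) λ t → iter f (toℕ t) x ≡ y
  sameCycle-bounded {x} {y} (t , e) with period x
  ... | p , p<n , back = fromℕ< r<n , reduced
    where
    r<n = ℕₚ.<-≤-trans (m%n<n t (suc p)) p<n
    reduced : iter f (toℕ (fromℕ< r<n)) x ≡ y
    reduced rewrite Finₚ.toℕ-fromℕ< r<n = begin
      iter f (t % suc p) x                                   ≡⟨ cong (iter f (t % suc p)) (iter-periodic (suc p) x back (t / suc p)) ⟨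
      iter f (t % suc p) (iter f ((t / suc p) * suc p) x)    ≡⟨ iter-+ f (t % suc p) ((t / suc p) * suc p) x ⟨
      iter f (t % suc p + (t / suc p) * suc p) x             ≡⟨ cong (λ u → iter f u x) (m≡m%n+[m/n]*n t (suc p)) ⟨
      iter f t x                                             ≡⟨ e ⟩
      y                                                      ∎
      where open ≡-Reasoning

  sameCycle? : ∀ x y → Dec (SameCycle x y)
  sameCycle? x y = map′ (λ (t , e) → toℕ t , e) sameCycle-bounded
                        (Finₚ.any? (λ t → iter f (toℕ t) x Finₚ.≟ y))

  sameCycle-refl : ∀ x → SameCycle x x
  sameCycle-refl x = 0 , refl

  sameCycle-step : ∀ x → SameCycle x (f x)
  sameCycle-step x = 1 , refl

  sameCycle-trans : ∀ {x y z} → SameCycle x y → SameCycle y z → SameCycle x z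
  sameCycle-trans {x} (t , e) (s , e′) = s + t , trans (iter-+ f s t x) (trans (cong (iter f s) e) e′)

  sameCycle-sym : ∀ {x y} → SameCycle x y → SameCycle y x
  sameCycle-sym {x} (t , refl) with period x
  ... | p , _ , back = t * p , (begin
    iter f (t * p) (iter f t x)   ≡⟨ iter-+ f (t * p) t x ⟨
    iter f (t * p + t) x          ≡⟨ cong (λ u → iter f u x) (trans (ℕₚ.+-comm (t * p) t) (sym (ℕₚ.*-suc t p))) ⟩
    iter f (t * suc p) x          ≡⟨ iter-periodic (suc p) x back t ⟩
    x                             ∎)
    where open ≡-Reasoning

  cycle-closed : (S : Fin n → Set) → (∀ z → S z → S (f z)) → ∀ {x y} → S x → SameCycle x y → S y
  cycle-closed S closed sx (zero  , refl) = sx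
  cycle-closed S closed sx (suc t , refl) = closed _ (cycle-closed S closed sx (t , refl))

  numCycles-classCount : numCycles π ≡ classCount sameCycle?
  numCycles-classCount =
    trans (length-filter-tabulate (isCycleMin? π) (λ x → x))
          (count-cong λ x → does-⇔ (mk⇔ (from-bounded x) (λ least t → least _ (toℕ t , refl)))
                                    (isCycleMin? π x) (isLeast? sameCycle? x))
    where
    from-bounded : ∀ x → IsCycleMin π x → IsLeast SameCycle x
    from-bounded x least y r with sameCycle-bounded r
    ... | t , e = subst (x ≤_) e (least t)

numCycles-cong : ∀ {n} (σ π : Permutation′ n) → (∀ x → σ ⟨$⟩ʳ x ≡ π ⟨$⟩ʳ x) → numCycles σ ≡ numCycles π
numCycles-cong {n} σ π e = begin
  numCycles σ                  ≡⟨ numCycles-classCount σ ⟩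
  classCount (sameCycle? σ)    ≡⟨ count-cong (λ x → does-⇔ (mk⇔ (along σ π e) (along π σ (sym ∘ e)))
                                                           (isLeast? (sameCycle? σ) x) (isLeast? (sameCycle? π) x)) ⟩
  classCount (sameCycle? π)    ≡⟨ numCycles-classCount π ⟨
  numCycles π                  ∎
  where
  open ≡-Reasoning
  along : ∀ (ρ θ : Permutation′ n) → (∀ x → ρ ⟨$⟩ʳ x ≡ θ ⟨$⟩ʳ x) →
    ∀ {x} → IsLeast (SameCycle ρ) x → IsLeast (SameCycle θ) x
  along ρ θ e least y (t , r) = least y (t , trans (iter-cong e t _) r)

numCycles-≤ : ∀ {n} (σ : Permutation′ n) → numCycles σ ℕ.≤ n
numCycles-≤ σ = subst (ℕ._≤ _) (sym (numCycles-classCount σ)) (count-≤ _)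

-- 0 is always least in its cycle
numCycles-pos : ∀ {n} (σ : Permutation′ (suc n)) → 1 ℕ.≤ numCycles σ
numCycles-pos σ = subst (1 ℕ.≤_) (sym (numCycles-classCount σ))
  (count-pos (λ x → does (isLeast? (sameCycle? σ) x)) (dec-true (isLeast? (sameCycle? σ) 0F) (λ y _ → z≤n)))

-- Splitting one class of an equivalence relation into two adds exactly
-- one class.  This is
-- the counting core of "a transposition splits or joins one cycle".
module Refinement {n : ℕ} {R R′ : Fin n → Fin n → Set}
  (R? : ∀ x y → Dec (R x y)) (R′? : ∀ x y → Dec (R′ x y))
  (R-sym : ∀ {x y} → R x y → R y x) (R-trans : ∀ {x y z} → R x y → R y z → R x z)
  (R′-refl : ∀ x → R′ x x) (R′-sym : ∀ {x y} → R′ x y → R′ y x)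
  (R′-trans : ∀ {x y z} → R′ x y → R′ y z → R′ x z)
  (R′⊆R : ∀ {x y} → R′ x y → R x y) where

  Covers Unchanged : Fin n → Fin n → Set
  Covers a b    = ∀ x → R x a → R′ x a ⊎ R′ x b
  Unchanged a b = ∀ x y → ¬ R x a → R x y → R′ x y

  -- The split class, with least elements mu ≤ mv of its two R′-parts:
  -- the R′-least elements are the R-least elements together with mv.
  private
    module Ordered (u v : Fin n) (Ruv : R u v) (u≁v : ¬ R′ u v)
      (covers : Covers u v) (unchanged : Unchanged u v)
      (mu : Fin n) (u∼mu : R′ u mu) (mu-least : ∀ y → R′ u y → mu ≤ y)
      (mv : Fin n) (v∼mv : R′ v mv) (mv-least : ∀ y → R′ v y → mv ≤ y)
      (mu≤mv : mu ≤ mv) where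

      mu-least-in-R : IsLeast R mu
      mu-least-in-R y r with covers y (R-trans (R-sym r) (R-sym (R′⊆R u∼mu)))
      ... | inj₁ y∼u = mu-least y (R′-sym y∼u)
      ... | inj₂ y∼v = Finₚ.≤-trans mu≤mv (mv-least y (R′-sym y∼v))

      least-R′⇒least-R : ∀ x → x ≢ mv → IsLeast R′ x → IsLeast R x
      least-R′⇒least-R x x≢mv least with R? x u
      ... | no x≁u = λ y r → least y (unchanged x y x≁u r)
      ... | yes x∼u with covers x x∼u
      ...   | inj₁ x∼′u = subst (IsLeast R) (sym x≡mu) mu-least-in-R
        where
        x≡mu = Finₚ.≤-antisym (least mu (R′-trans x∼′u u∼mu)) (mu-least x (R′-sym x∼′u))
      ...   | inj₂ x∼′v = ⊥-elim (x≢mv (Finₚ.≤-antisym (least mv (R′-trans x∼′v v∼mv)) (mv-least x (R′-sym x∼′v))))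

      mv-least-in-R′ : IsLeast R′ mv
      mv-least-in-R′ y r = mv-least y (R′-trans v∼mv r)

      -- mv is R-equivalent to mu ≤ mv, so it is not R-least
      mv-not-least-in-R : ¬ IsLeast R mv
      mv-not-least-in-R least = u≁v (R′-trans (subst (R′ u) mu≡mv u∼mu) (R′-sym v∼mv))
        where
        mv∼mu = R-trans (R-sym (R′⊆R v∼mv)) (R-trans (R-sym Ruv) (R′⊆R u∼mu))
        mu≡mv = Finₚ.≤-antisym mu≤mv (least mu mv∼mu)

      classCount-suc : classCount R′? ≡ suc (classCount R?)
      classCount-suc = count-drop mv
        (λ x x≢mv → does-⇔ (mk⇔ (least-R′⇒least-R x x≢mv) (λ least y r → least y (R′⊆R r)))
                              (isLeast? R′? x) (isLeast? R? x))
        (dec-true (isLeast? R′? mv) mv-least-in-R′)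
        (dec-false (isLeast? R? mv) mv-not-least-in-R)

  splits-one-class : (a b : Fin n) → R a b → ¬ R′ a b → Covers a b → Unchanged a b →
    classCount R′? ≡ suc (classCount R?)
  splits-one-class a b Rab a≁b covers unchanged
    with minimum (R′? a) (R′-refl a) | minimum (R′? b) (R′-refl b)
  ... | ma , a∼ma , ma-least | mb , b∼mb , mb-least with ma Finₚ.≤? mb
  ... | yes ma≤mb = Ordered.classCount-suc a b Rab a≁b covers unchanged
                      ma a∼ma ma-least mb b∼mb mb-least ma≤mb
  ... | no  ma≰mb = Ordered.classCount-suc b a (R-sym Rab) (a≁b ∘ R′-sym) covers′ unchanged′
                      mb b∼mb mb-least ma a∼ma ma-least (ℕₚ.<⇒≤ (ℕₚ.≰⇒> ma≰mb))
    where
    covers′ : Covers b a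
    covers′ x r with covers x (R-trans r (R-sym Rab))
    ... | inj₁ x∼a = inj₂ x∼a
    ... | inj₂ x∼b = inj₁ x∼b
    unchanged′ : Unchanged b a
    unchanged′ x y x≁b = unchanged x y (λ x∼a → x≁b (R-trans x∼a Rab))

transpose-left : ∀ {n} (a b : Fin n) → PC.transpose a b a ≡ b
transpose-left a b rewrite dec-true (a Finₚ.≟ a) refl = refl

transpose-right : ∀ {n} (a b : Fin n) → PC.transpose a b b ≡ a
transpose-right a b with b Finₚ.≟ a
... | yes b≡a = b≡a
... | no  _   rewrite dec-true (b Finₚ.≟ b) refl = refl

transpose-other : ∀ {n} (a b k : Fin n) → k ≢ a → k ≢ b → PC.transpose a b k ≡ k
transpose-other a b k k≢a k≢b rewrite dec-false (k Finₚ.≟ a) k≢a | dec-false (k Finₚ.≟ b) k≢b = refl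

TransposeCase : ∀ {n} (a b k : Fin n) → Set
TransposeCase a b k = (k ≡ a × PC.transpose a b k ≡ b) ⊎ (k ≡ b × PC.transpose a b k ≡ a) ⊎
                      (k ≢ a × k ≢ b × PC.transpose a b k ≡ k)

transpose-cases : ∀ {n} (a b k : Fin n) → TransposeCase a b k
transpose-cases a b k = by (k Finₚ.≟ a) (k Finₚ.≟ b)
  where
  by : Dec (k ≡ a) → Dec (k ≡ b) → TransposeCase a b k
  by (yes k≡a) _         = inj₁ (k≡a , trans (cong (PC.transpose a b) k≡a) (transpose-left a b))
  by (no  _)   (yes k≡b) = inj₂ (inj₁ (k≡b , trans (cong (PC.transpose a b) k≡b) (transpose-right a b)))
  by (no  k≢a) (no  k≢b) = inj₂ (inj₂ (k≢a , k≢b , transpose-other a b k k≢a k≢b))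

transpose-comm : ∀ {n} (a b k : Fin n) → PC.transpose a b k ≡ PC.transpose b a k
transpose-comm a b k with transpose-cases a b k
... | inj₁ (refl , t)               = trans t (sym (transpose-right b k))
... | inj₂ (inj₁ (refl , t))        = trans t (sym (transpose-left k a))
... | inj₂ (inj₂ (k≢a , k≢b , t))   = trans t (sym (transpose-other b a k k≢b k≢a))

transpose-involutive : ∀ {n} (a b k : Fin n) → PC.transpose a b (PC.transpose a b k) ≡ k
transpose-involutive a b k = trans (cong (PC.transpose a b) (transpose-comm a b k)) (PC.transpose-inverse a b)

transpose-closed : ∀ {n} (S : Fin n → Set) (a b : Fin n) → (S a × S b) ⊎ (¬ S a × ¬ S b) →
  ∀ k → S k → S (PC.transpose a b k)
transpose-closed S a b both-or-neither k sk with transpose-cases a b k | both-or-neither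
... | inj₁ (refl , t)          | inj₁ (_ , sb)    = subst S (sym t) sb
... | inj₁ (refl , t)          | inj₂ (¬sa , _)   = ⊥-elim (¬sa sk)
... | inj₂ (inj₁ (refl , t))   | inj₁ (sa , _)    = subst S (sym t) sa
... | inj₂ (inj₁ (refl , t))   | inj₂ (_ , ¬sb)   = ⊥-elim (¬sb sk)
... | inj₂ (inj₂ (_ , _ , t))  | _                = subst S (sym t) sk

-- Left multiplication by (a b), for a and b on one cycle of σ, splits
-- that cycle in two: the arc a, σ a, …, up to the point before b, and
-- the rest.  Every other cycle is untouched.
module SplitCycle {n : ℕ} (σ : Permutation′ n) (a b : Fin n) (a≢b : a ≢ b) (a∼b : SameCycle σ a b) where
  private
    ρ : Permutation′ n
    ρ = transpose a b · σ
    f g : Fin n → Fin n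
    f = σ ⟨$⟩ʳ_
    g = ρ ⟨$⟩ʳ_

  step-within : ∀ z → SameCycle σ z (g z)
  step-within z with transpose-cases a b (f z)
  ... | inj₁ (fz≡a , t)         = subst (SameCycle σ z) (sym t) (sameCycle-trans σ (1 , fz≡a) a∼b)
  ... | inj₂ (inj₁ (fz≡b , t))  = subst (SameCycle σ z) (sym t) (sameCycle-trans σ (1 , fz≡b) (sameCycle-sym σ a∼b))
  ... | inj₂ (inj₂ (_ , _ , t)) = 1 , sym t

  refines : ∀ {x y} → SameCycle ρ x y → SameCycle σ x y
  refines {x} = cycle-closed ρ (SameCycle σ x) (λ z x∼z → sameCycle-trans σ x∼z (step-within z)) (sameCycle-refl σ x)

  -- r + 1 is the first time the σ-orbit of a returns to {a, b}
  private
    Returns : ℕ → Set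
    Returns t = iter f (suc t) a ≡ a ⊎ iter f (suc t) a ≡ b

    first-return : Σ ℕ λ r → Returns r × (∀ t → t ℕ.< r → ¬ Returns t)
    first-return = least-witness (λ t → (iter f (suc t) a Finₚ.≟ a) ⊎-dec (iter f (suc t) a Finₚ.≟ b))
                                 (proj₁ (period σ a)) (inj₁ (proj₂ (proj₂ (period σ a))))

    r : ℕ
    r = proj₁ first-return
    returns : Returns r
    returns = proj₁ (proj₂ first-return)
    not-before : ∀ t → t ℕ.< r → ¬ Returns t
    not-before = proj₂ (proj₂ first-return)

  OnArc : Fin n → Set
  OnArc z = Σ ℕ λ t → t ℕ.≤ r × iter f t a ≡ z

  arc-avoids-b : ∀ {z} → OnArc z → z ≢ b
  arc-avoids-b (zero  , _   , refl) = a≢b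
  arc-avoids-b (suc t , t<r , refl) = not-before t t<r ∘ inj₂

  -- the arc ends just before b, since b is on the cycle of a
  returns-to-b : iter f (suc r) a ≡ b
  returns-to-b with returns
  ... | inj₂ hits-b = hits-b
  ... | inj₁ hits-a = ⊥-elim (arc-avoids-b (cycle-closed σ OnArc arc-closed (0 , z≤n , refl) a∼b) refl)
    where
    arc-closed : ∀ z → OnArc z → OnArc (f z)
    arc-closed z (t , t≤r , refl) with ℕₚ.m≤n⇒m<n∨m≡n t≤r
    ... | inj₁ t<r  = suc t , t<r , refl
    ... | inj₂ refl = 0 , z≤n , sym hits-a

  -- under ρ the arc closes up into a cycle, which misses b
  arc-closed-under-ρ : ∀ z → OnArc z → OnArc (g z)
  arc-closed-under-ρ z (t , t≤r , refl) with ℕₚ.m≤n⇒m<n∨m≡n t≤r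
  ... | inj₁ t<r  = suc t , t<r , sym (transpose-other a b _ (not-before t t<r ∘ inj₁) (not-before t t<r ∘ inj₂))
  ... | inj₂ refl = 0 , z≤n , sym (trans (cong (PC.transpose a b) returns-to-b) (transpose-right a b))

  separated : ¬ SameCycle ρ a b
  separated a∼′b = arc-avoids-b (cycle-closed ρ OnArc arc-closed-under-ρ (0 , z≤n , refl) a∼′b) refl

  covers : ∀ x → SameCycle σ x a → SameCycle ρ x a ⊎ SameCycle ρ x b
  covers x x∼a = map⊎ (sameCycle-sym ρ) (sameCycle-sym ρ)
    (cycle-closed σ OnNew closed (inj₁ (sameCycle-refl ρ a)) (sameCycle-sym σ x∼a))
    where
    OnNew : Fin n → Set
    OnNew z = SameCycle ρ a z ⊎ SameCycle ρ b z
    closed : ∀ z → OnNew z → OnNew (f z)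
    closed z on with transpose-cases a b (f z)
    ... | inj₁ (fz≡a , _)         = inj₁ (0 , sym fz≡a)
    ... | inj₂ (inj₁ (fz≡b , _))  = inj₂ (0 , sym fz≡b)
    ... | inj₂ (inj₂ (_ , _ , t)) = map⊎ extend extend on
      where
      extend : ∀ {c} → SameCycle ρ c z → SameCycle ρ c (f z)
      extend q = subst (SameCycle ρ _) t (sameCycle-trans ρ q (sameCycle-step ρ z))

  unchanged : ∀ x y → ¬ SameCycle σ x a → SameCycle σ x y → SameCycle ρ x y
  unchanged x y x≁a = cycle-closed σ (SameCycle ρ x) closed (sameCycle-refl ρ x)
    where
    closed : ∀ z → SameCycle ρ x z → SameCycle ρ x (f z)
    closed z q with transpose-cases a b (f z)
    ... | inj₁ (fz≡a , _)         = ⊥-elim (x≁a (sameCycle-trans σ (refines q) (1 , fz≡a)))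
    ... | inj₂ (inj₁ (fz≡b , _))  =
      ⊥-elim (x≁a (sameCycle-trans σ (sameCycle-trans σ (refines q) (1 , fz≡b)) (sameCycle-sym σ a∼b)))
    ... | inj₂ (inj₂ (_ , _ , t)) = subst (SameCycle ρ x) t (sameCycle-trans ρ q (sameCycle-step ρ z))

  numCycles-split : numCycles ρ ≡ suc (numCycles σ)
  numCycles-split = begin
    numCycles ρ                     ≡⟨ numCycles-classCount ρ ⟩
    classCount (sameCycle? ρ)       ≡⟨ R.splits-one-class a b a∼b separated covers unchanged ⟩
    suc (classCount (sameCycle? σ)) ≡⟨ cong suc (numCycles-classCount σ) ⟨
    suc (numCycles σ)               ∎
    where
    open ≡-Reasoning
    module R = Refinement (sameCycle? σ) (sameCycle? ρ) (sameCycle-sym σ) (sameCycle-trans σ)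
                 (sameCycle-refl ρ) (sameCycle-sym ρ) (sameCycle-trans ρ) refines

-- If a and b lie on different cycles of σ, then (a b) joins them: the
-- product (a b) · σ has a and b on one cycle, and splitting it again
-- gives back σ.
numCycles-join : ∀ {n} (σ : Permutation′ n) (a b : Fin n) → a ≢ b → ¬ SameCycle σ a b →
  suc (numCycles (transpose a b · σ)) ≡ numCycles σ
numCycles-join {n} σ a b a≢b a≁b =
  trans (sym (SplitCycle.numCycles-split ρ a b a≢b joined))
        (numCycles-cong (transpose a b · ρ) σ (λ x → transpose-involutive a b _))
  where
  ρ : Permutation′ n
  ρ = transpose a b · σ
  f g : Fin n → Fin n
  f = σ ⟨$⟩ʳ_
  g = ρ ⟨$⟩ʳ_
  -- u + 1 is the period of b under σ
  first-return : Σ ℕ λ u → iter f (suc u) b ≡ b × (∀ t → t ℕ.< u → iter f (suc t) b ≢ b)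
  first-return = least-witness (λ t → iter f (suc t) b Finₚ.≟ b)
                                 (proj₁ (period σ b)) (proj₂ (proj₂ (period σ b)))
  u : ℕ
  u = proj₁ first-return
  -- along that period, ρ follows σ: the orbit of b never meets a
  follows : ∀ t → t ℕ.≤ u → iter g t b ≡ iter f t b
  follows zero    _   = refl
  follows (suc t) t<u = trans (cong g (follows t (ℕₚ.<⇒≤ t<u)))
    (transpose-other a b _ (λ e → a≁b (sameCycle-sym σ (suc t , e))) (proj₂ (proj₂ first-return) t t<u))
  joined : SameCycle ρ a b
  joined = sameCycle-sym ρ (suc u , (begin
    g (iter g u b)               ≡⟨ cong g (follows u ℕₚ.≤-refl) ⟩
    PC.transpose a b (f (iter f u b)) ≡⟨ cong (PC.transpose a b) (proj₁ (proj₂ first-return)) ⟩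
    PC.transpose a b b           ≡⟨ transpose-right a b ⟩
    a                            ∎))
    where open ≡-Reasoning

numCycles-transpose-≤ : ∀ {n} (σ : Permutation′ n) (a b : Fin n) → a ≢ b →
  numCycles (transpose a b · σ) ℕ.≤ suc (numCycles σ)
numCycles-transpose-≤ σ a b a≢b with sameCycle? σ a b
... | yes a∼b = ℕₚ.≤-reflexive (SplitCycle.numCycles-split σ a b a≢b a∼b)
... | no  a≁b = ℕₚ.m≤n⇒m≤1+n (ℕₚ.≤-trans (ℕₚ.n≤1+n _) (ℕₚ.≤-reflexive (numCycles-join σ a b a≢b a≁b)))

Sorted : ∀ {n k} → (Fin k → Transposition n) → Set
Sorted τ = ∀ l m → l ≤ m → i (τ l) ≤ i (τ m)

NonCrossingPair : ∀ {n} → Transposition n → Transposition n → Set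
NonCrossingPair t u = j t ≤ i u ⊎ j u < j t

nonCrossingPair? : ∀ {n} (t u : Transposition n) → Dec (NonCrossingPair t u)
nonCrossingPair? t u = (j t Finₚ.≤? i u) ⊎-dec (j u Finₚ.<? j t)

NonCrossing : ∀ {n k} → (Fin k → Transposition n) → Set
NonCrossing τ = ∀ l m → l < m → NonCrossingPair (τ l) (τ m)

sorted-tail : ∀ {n k} (τ : Fin (suc k) → Transposition n) → Sorted τ → Sorted (tail τ)
sorted-tail τ sorted l m l≤m = sorted (sucF l) (sucF m) (s≤s l≤m)

nonCrossing-tail : ∀ {n k} (τ : Fin (suc k) → Transposition n) → NonCrossing τ → NonCrossing (tail τ)
nonCrossing-tail τ nc l m l<m = nc (sucF l) (sucF m) (s<s l<m)

i≢j : ∀ {n} (t : Transposition n) → i t ≢ j t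
i≢j t i≡j = ℕₚ.<-irrefl (cong toℕ i≡j) (i<j t)

InInterval : ∀ {n} → Transposition n → Fin n → Set
InInterval t x = i t ≤ x × x < j t

i-inInterval : ∀ {n} (t : Transposition n) → InInterval t (i t)
i-inInterval t = ℕₚ.≤-refl , i<j t

j-notInInterval : ∀ {n} (t : Transposition n) → ¬ InInterval t (j t)
j-notInInterval t (_ , j<j) = ℕₚ.<-irrefl refl j<j

Respects : ∀ {n} → (Fin n → Set) → Transposition n → Set
Respects S t = (S (i t) × S (j t)) ⊎ (¬ S (i t) × ¬ S (j t))

respects-interval : ∀ {n} (t u : Transposition n) → i t ≤ i u → NonCrossingPair t u → Respects (InInterval t) u
respects-interval t u it≤iu (inj₁ jt≤iu) =
  inj₂ ( (λ (_ , iu<jt) → ℕₚ.<⇒≱ iu<jt jt≤iu)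
       , (λ (_ , ju<jt) → ℕₚ.<⇒≱ ju<jt (ℕₚ.≤-trans jt≤iu (ℕₚ.<⇒≤ (i<j u)))))
respects-interval t u it≤iu (inj₂ ju<jt) =
  inj₁ ((it≤iu , ℕₚ.<-trans (i<j u) ju<jt) , (ℕₚ.≤-trans it≤iu (ℕₚ.<⇒≤ (i<j u)) , ju<jt))

product-closed : ∀ {n k} (τ : Fin k → Transposition n) (S : Fin n → Set) → (∀ l → Respects S (τ l)) →
  ∀ x → S x → S (prod τ ⟨$⟩ʳ x)
product-closed {k = zero}  τ S respects x sx = sx
product-closed {k = suc k} τ S respects x sx =
  transpose-closed S (i (head τ)) (j (head τ)) (respects 0F) _ (product-closed (tail τ) S (respects ∘ sucF) x sx)

-- Under the theorem's condition every transposition joins two cycles of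
-- the product of the later ones (the interval of the first transposition
-- is a union of their cycles), so prod τ has n - k cycles.
numCycles-product : ∀ {n k} (τ : Fin k → Transposition n) → Sorted τ → NonCrossing τ →
  numCycles (prod τ) + k ≡ n
numCycles-product {n} {zero}  τ sorted nc = trans (ℕₚ.+-identityʳ _) (trans (numCycles-classCount (id {n})) all-least)
  where
  iter-id : ∀ t (x : Fin n) → iter (id ⟨$⟩ʳ_) t x ≡ x
  iter-id zero    x = refl
  iter-id (suc t) x = iter-id t x
  all-least : classCount (sameCycle? (id {n})) ≡ n
  all-least = count-all λ x → dec-true (isLeast? (sameCycle? (id {n})) x)
    λ { y (t , refl) → ℕₚ.≤-reflexive (cong toℕ (sym (iter-id t x))) }
numCycles-product {n} {suc k} τ sorted nc = begin
  numCycles (prod τ) + suc k        ≡⟨ ℕₚ.+-suc (numCycles (prod τ)) k ⟩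
  suc (numCycles (prod τ)) + k      ≡⟨ cong (_+ k) (numCycles-join P (i t) (j t) (i≢j t) separated) ⟩
  numCycles P + k                   ≡⟨ numCycles-product (tail τ) (sorted-tail τ sorted) (nonCrossing-tail τ nc) ⟩
  n                                 ∎
  where
  open ≡-Reasoning
  t = head τ
  P = prod (tail τ)
  separated : ¬ SameCycle P (i t) (j t)
  separated i∼j = j-notInInterval t (cycle-closed P (InInterval t)
    (product-closed (tail τ) (InInterval t) (λ l → respects-interval t (τ (sucF l)) (sorted 0F (sucF l) z≤n) (nc 0F (sucF l) z<s)))
    (i-inInterval t) i∼j)

-- β moves each point of the interval of t one step up, as the long
-- cycle x ↦ x + 1 does on every interval.
ShiftsInterval : ∀ {n} → Permutation′ n → Transposition n → Set
ShiftsInterval β t = ∀ x → InInterval t x → toℕ (β ⟨$⟩ʳ x) ≡ suc (toℕ x)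

climb : ∀ {n} (β : Permutation′ n) (a : Fin n) d →
  (∀ x → toℕ a ℕ.≤ toℕ x → toℕ x ℕ.< toℕ a + d → toℕ (β ⟨$⟩ʳ x) ≡ suc (toℕ x)) →
  toℕ (iter (β ⟨$⟩ʳ_) d a) ≡ toℕ a + d
climb β a zero    step = sym (ℕₚ.+-identityʳ (toℕ a))
climb β a (suc d) step = begin
  toℕ (β ⟨$⟩ʳ iter (β ⟨$⟩ʳ_) d a)  ≡⟨ step _ (subst (toℕ a ℕ.≤_) (sym ih) (ℕₚ.m≤m+n (toℕ a) d))
                                            (subst (ℕ._< toℕ a + suc d) (sym ih) (ℕₚ.+-monoʳ-< (toℕ a) (ℕₚ.n<1+n d))) ⟩
  suc (toℕ (iter (β ⟨$⟩ʳ_) d a))   ≡⟨ cong suc ih ⟩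
  suc (toℕ a + d)                  ≡⟨ ℕₚ.+-suc (toℕ a) d ⟨
  toℕ a + suc d                    ∎
  where
  open ≡-Reasoning
  ih = climb β a d (λ x a≤x x<a+d → step x a≤x (ℕₚ.<-trans x<a+d (ℕₚ.+-monoʳ-< (toℕ a) (ℕₚ.n<1+n d))))

shifts-sameCycle : ∀ {n} (β : Permutation′ n) (t : Transposition n) → ShiftsInterval β t → SameCycle β (i t) (j t)
shifts-sameCycle β t shifts = toℕ (j t) ∸ toℕ (i t) ,
  Finₚ.toℕ-injective (trans (climb β (i t) _ (λ x i≤x x<i+d → shifts x (i≤x , subst (toℕ x ℕ.<_) i+d≡j x<i+d))) i+d≡j)
  where
  i+d≡j = ℕₚ.m+[n∸m]≡n (ℕₚ.<⇒≤ (i<j t))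

-- Multiplying by an earlier transposition t non-crossing with u keeps the
-- shift on the interval of u: there β x = x + 1 is neither i t nor j t.
shifts-transpose : ∀ {n} (β : Permutation′ n) (t u : Transposition n) → i t ≤ i u → NonCrossingPair t u →
  ShiftsInterval β u → ShiftsInterval (toPerm t · β) u
shifts-transpose β t u it≤iu nc shifts x x∈u =
  trans (cong toℕ (transpose-other (i t) (j t) (β ⟨$⟩ʳ x) βx≢i βx≢j)) βx≡x+1
  where
  βx≡x+1 = shifts x x∈u
  βx≢i : β ⟨$⟩ʳ x ≢ i t
  βx≢i e = ℕₚ.<-irrefl refl (ℕₚ.≤-<-trans (ℕₚ.≤-trans it≤iu (proj₁ x∈u))
             (subst (toℕ x ℕ.<_) (trans (sym βx≡x+1) (cong toℕ e)) (ℕₚ.n<1+n _)))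
  βx≢j : β ⟨$⟩ʳ x ≢ j t
  βx≢j e = after-or-inside nc
    where
    after-or-inside : NonCrossingPair t u → ⊥
    after-or-inside (inj₁ jt≤iu) = ℕₚ.<⇒≱ (ℕₚ.n<1+n (toℕ x))
      (subst (ℕ._≤ toℕ x) (trans (cong toℕ (sym e)) βx≡x+1) (ℕₚ.≤-trans jt≤iu (proj₁ x∈u)))
    after-or-inside (inj₂ ju<jt) = ℕₚ.<-irrefl (trans (sym βx≡x+1) (cong toℕ e)) (ℕₚ.≤-<-trans (proj₂ x∈u) ju<jt)

numCycles-unfold : ∀ {n k} (τ : Fin (suc k) → Transposition n) (β : Permutation′ n) →
  numCycles (prod τ ⁻¹ · β) ≡ numCycles (prod (tail τ) ⁻¹ · (toPerm (head τ) · β))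
numCycles-unfold τ β = numCycles-cong (prod τ ⁻¹ · β) (prod (tail τ) ⁻¹ · (toPerm (head τ) · β))
  (λ x → cong (prod (tail τ) ⟨$⟩ˡ_) (transpose-comm (j (head τ)) (i (head τ)) (β ⟨$⟩ʳ x)))

numCycles-empty : ∀ {n} (τ : Fin 0 → Transposition n) (β : Permutation′ n) → numCycles (prod τ ⁻¹ · β) ≡ numCycles β + 0
numCycles-empty τ β = trans (numCycles-cong (prod τ ⁻¹ · β) β (λ x → refl)) (sym (ℕₚ.+-identityʳ _))

Shifts : ∀ {n k} → Permutation′ n → (Fin k → Transposition n) → Set
Shifts β τ = ∀ l → ShiftsInterval β (τ l)

shifts-tail : ∀ {n k} (τ : Fin (suc k) → Transposition n) (β : Permutation′ n) → Sorted τ →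
  (∀ m → NonCrossingPair (head τ) (tail τ m)) → Shifts β τ → Shifts (toPerm (head τ) · β) (tail τ)
shifts-tail τ β sorted nc-head shifts l =
  shifts-transpose β (head τ) (tail τ l) (sorted 0F (sucF l) z≤n) (nc-head l) (shifts (sucF l))

-- Under the theorem's condition, if β shifts every interval, then each of
-- τ₁, τ₂, … in turn splits a cycle of τᵢ₋₁ ⋯ τ₁ β.
numCycles-after : ∀ {n k} (τ : Fin k → Transposition n) (β : Permutation′ n) → Sorted τ → NonCrossing τ →
  Shifts β τ → numCycles (prod τ ⁻¹ · β) ≡ numCycles β + k
numCycles-after {k = zero}  τ β sorted nc shifts = numCycles-empty τ β
numCycles-after {k = suc k} τ β sorted nc shifts = begin
  numCycles (prod τ ⁻¹ · β)               ≡⟨ numCycles-unfold τ β ⟩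
  numCycles (prod (tail τ) ⁻¹ · β′)       ≡⟨ numCycles-after (tail τ) β′ (sorted-tail τ sorted) (nonCrossing-tail τ nc) shifts′ ⟩
  numCycles β′ + k                        ≡⟨ cong (_+ k) splits ⟩
  suc (numCycles β) + k                   ≡⟨ ℕₚ.+-suc (numCycles β) k ⟨
  numCycles β + suc k                     ∎
  where
  open ≡-Reasoning
  t = head τ
  β′ = toPerm t · β
  shifts′ = shifts-tail τ β sorted (λ m → nc 0F (sucF m) z<s) shifts
  splits : numCycles β′ ≡ suc (numCycles β)
  splits = SplitCycle.numCycles-split β (i t) (j t) (i≢j t) (shifts-sameCycle β t (shifts 0F))

numCycles-after-≤ : ∀ {n k} (τ : Fin k → Transposition n) (β : Permutation′ n) →
  numCycles (prod τ ⁻¹ · β) ℕ.≤ numCycles β + k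
numCycles-after-≤ {k = zero}  τ β = ℕₚ.≤-reflexive (numCycles-empty τ β)
numCycles-after-≤ {k = suc k} τ β = begin
  numCycles (prod τ ⁻¹ · β)               ≡⟨ numCycles-unfold τ β ⟩
  numCycles (prod (tail τ) ⁻¹ · β′)       ≤⟨ numCycles-after-≤ (tail τ) β′ ⟩
  numCycles β′ + k                        ≤⟨ ℕₚ.+-monoˡ-≤ k (numCycles-transpose-≤ β (i t) (j t) (i≢j t)) ⟩
  suc (numCycles β) + k                   ≡⟨ ℕₚ.+-suc (numCycles β) k ⟨
  numCycles β + suc k                     ∎
  where
  open ℕₚ.≤-Reasoning
  t = head τ
  β′ = toPerm t · β

numCycles-after-< : ∀ {n k} (τ : Fin k → Transposition n) (β : Permutation′ n) (S : Fin n → Set) →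
  (∀ x → S x → S (β ⟨$⟩ʳ x)) → (m : Fin k) → (∀ p → p < m → Respects S (τ p)) →
  S (i (τ m)) → ¬ S (j (τ m)) → suc (numCycles (prod τ ⁻¹ · β)) ℕ.≤ numCycles β + k
numCycles-after-< {k = suc k} τ β S closed 0F _ si ¬sj = begin
  suc (numCycles (prod τ ⁻¹ · β))           ≡⟨ cong suc (numCycles-unfold τ β) ⟩
  suc (numCycles (prod (tail τ) ⁻¹ · β′))   ≤⟨ s≤s (numCycles-after-≤ (tail τ) β′) ⟩
  suc (numCycles β′) + k                    ≡⟨ cong (_+ k) (numCycles-join β (i t) (j t) (i≢j t) separated) ⟩
  numCycles β + k                           ≤⟨ ℕₚ.+-monoʳ-≤ (numCycles β) (ℕₚ.n≤1+n k) ⟩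
  numCycles β + suc k                       ∎
  where
  open ℕₚ.≤-Reasoning
  t = head τ
  β′ = toPerm t · β
  separated : ¬ SameCycle β (i t) (j t)
  separated i∼j = ¬sj (cycle-closed β S closed si i∼j)
-- otherwise the first transposition respects S, which stays a union of cycles
numCycles-after-< {k = suc k} τ β S closed (sucF m) respects si ¬sj = begin
  suc (numCycles (prod τ ⁻¹ · β))           ≡⟨ cong suc (numCycles-unfold τ β) ⟩
  suc (numCycles (prod (tail τ) ⁻¹ · β′))   ≤⟨ numCycles-after-< (tail τ) β′ S closed′ m respects′ si ¬sj ⟩
  numCycles β′ + k                          ≤⟨ ℕₚ.+-monoˡ-≤ k (numCycles-transpose-≤ β (i t) (j t) (i≢j t)) ⟩
  suc (numCycles β) + k                     ≡⟨ ℕₚ.+-suc (numCycles β) k ⟨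
  numCycles β + suc k                       ∎
  where
  open ℕₚ.≤-Reasoning
  t = head τ
  β′ = toPerm t · β
  closed′ : ∀ x → S x → S (β′ ⟨$⟩ʳ x)
  closed′ x sx = transpose-closed S (i t) (j t) (respects 0F z<s) _ (closed x sx)
  respects′ : ∀ p → p < m → Respects S (tail τ p)
  respects′ p p<m = respects (sucF p) (s<s p<m)

-- If β shifts the interval of t, then t · β cycles the interval
-- i → i + 1 → ⋯ → j - 1 → i; in particular the interval is closed under it.
interval-closed : ∀ {n} (β : Permutation′ n) (t : Transposition n) → ShiftsInterval β t →
  ∀ x → InInterval t x → InInterval t ((toPerm t · β) ⟨$⟩ʳ x)
interval-closed β t shifts x x∈t@(i≤x , x<j) with transpose-cases (i t) (j t) (β ⟨$⟩ʳ x)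
... | inj₁ (βx≡i , _) = ⊥-elim (ℕₚ.<-irrefl refl
      (ℕₚ.≤-<-trans i≤x (subst (toℕ x ℕ.<_) (trans (sym βx≡x+1) (cong toℕ βx≡i)) (ℕₚ.n<1+n _))))
  where βx≡x+1 = shifts x x∈t
... | inj₂ (inj₁ (_ , image≡i)) = subst (InInterval t) (sym image≡i) (i-inInterval t)
... | inj₂ (inj₂ (_ , βx≢j , image≡βx)) = subst (InInterval t) (sym image≡βx)
      (subst (toℕ (i t) ℕ.≤_) (sym βx≡x+1) (ℕₚ.m≤n⇒m≤1+n i≤x) ,
       ℕₚ.≤∧≢⇒< (subst (ℕ._≤ toℕ (j t)) (sym βx≡x+1) x<j) (βx≢j ∘ Finₚ.toℕ-injective))
  where βx≡x+1 = shifts x x∈t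

-- If the cycle count grows by the full k, the first transposition is
-- non-crossing with every later one: otherwise the least later one
-- crossing it would join two cycles inside its interval.
head-nonCrossing : ∀ {n k} (τ : Fin (suc k) → Transposition n) (β : Permutation′ n) → Sorted τ → Shifts β τ →
  numCycles (prod τ ⁻¹ · β) ≡ numCycles β + suc k → ∀ m → NonCrossingPair (head τ) (tail τ m)
head-nonCrossing {k = k} τ β sorted shifts attained m with nonCrossingPair? (head τ) (tail τ m)
... | yes ok       = ok
... | no  crossing = ⊥-elim (ℕₚ.<-irrefl refl (ℕₚ.<-≤-trans (s≤s (ℕₚ.≤-reflexive (sym attained′))) falls-short))
  where
  t = head τ
  β′ = toPerm t · β
  attained′ : numCycles (prod (tail τ) ⁻¹ · β′) ≡ numCycles β + suc k
  attained′ = trans (sym (numCycles-unfold τ β)) attained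
  first : Σ (Fin k) λ p → ¬ NonCrossingPair t (tail τ p) × (∀ q → ¬ NonCrossingPair t (tail τ q) → p ≤ q)
  first = minimum (λ p → ¬? (nonCrossingPair? t (tail τ p))) crossing
  m₀ : Fin k
  m₀ = proj₁ first
  u : Transposition _
  u = tail τ m₀
  crosses : ¬ NonCrossingPair t u
  crosses = proj₁ (proj₂ first)
  earlier : ∀ p → p < m₀ → Respects (InInterval t) (tail τ p)
  earlier p p<m₀ = respects-interval t (tail τ p) (sorted 0F (sucF p) z≤n)
    (decidable-stable (nonCrossingPair? t (tail τ p)) (λ bad → ℕₚ.<⇒≱ p<m₀ (proj₂ (proj₂ first) p bad)))
  iu∈t : InInterval t (i u)
  iu∈t = sorted 0F (sucF m₀) z≤n , ℕₚ.≰⇒> (crosses ∘ inj₁)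
  ju∉t : ¬ InInterval t (j u)
  ju∉t (_ , ju<jt) = crosses (inj₂ ju<jt)
  falls-short : suc (numCycles (prod (tail τ) ⁻¹ · β′)) ℕ.≤ numCycles β + suc k
  falls-short = begin
    suc (numCycles (prod (tail τ) ⁻¹ · β′)) ≤⟨ numCycles-after-< (tail τ) β′ (InInterval t) closed m₀ earlier iu∈t ju∉t ⟩
    numCycles β′ + k                        ≤⟨ ℕₚ.+-monoˡ-≤ k (numCycles-transpose-≤ β (i t) (j t) (i≢j t)) ⟩
    suc (numCycles β) + k                   ≡⟨ ℕₚ.+-suc (numCycles β) k ⟨
    numCycles β + suc k                     ∎
    where
    open ℕₚ.≤-Reasoning
    closed = interval-closed β t (shifts 0F)

head-splits : ∀ {n k} (τ : Fin (suc k) → Transposition n) (β : Permutation′ n) →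
  numCycles (prod τ ⁻¹ · β) ≡ numCycles β + suc k → numCycles (toPerm (head τ) · β) ≡ suc (numCycles β)
head-splits {k = k} τ β attained = ℕₚ.≤-antisym (numCycles-transpose-≤ β (i t) (j t) (i≢j t)) (ℕₚ.+-cancelʳ-≤ k _ _ (begin
  suc (numCycles β) + k                   ≡⟨ ℕₚ.+-suc (numCycles β) k ⟨
  numCycles β + suc k                     ≡⟨ trans (sym attained) (numCycles-unfold τ β) ⟩
  numCycles (prod (tail τ) ⁻¹ · β′)       ≤⟨ numCycles-after-≤ (tail τ) β′ ⟩
  numCycles β′ + k                        ∎))
  where
  open ℕₚ.≤-Reasoning
  t = head τ
  β′ = toPerm t · β

nonCrossing-of-attained : ∀ {n k} (τ : Fin k → Transposition n) (β : Permutation′ n) → Sorted τ → Shifts β τ →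
  numCycles (prod τ ⁻¹ · β) ≡ numCycles β + k → NonCrossing τ
nonCrossing-of-attained {k = zero}  τ β sorted shifts attained ()
nonCrossing-of-attained {k = suc k} τ β sorted shifts attained = nonCrossing
  where
  t = head τ
  β′ = toPerm t · β
  head-ok : ∀ m → NonCrossingPair t (tail τ m)
  head-ok = head-nonCrossing τ β sorted shifts attained
  attained′ : numCycles (prod (tail τ) ⁻¹ · β′) ≡ numCycles β′ + k
  attained′ = begin
    numCycles (prod (tail τ) ⁻¹ · β′)     ≡⟨ numCycles-unfold τ β ⟨
    numCycles (prod τ ⁻¹ · β)             ≡⟨ attained ⟩
    numCycles β + suc k                   ≡⟨ ℕₚ.+-suc (numCycles β) k ⟩
    suc (numCycles β) + k                 ≡⟨ cong (_+ k) (head-splits τ β attained) ⟨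
    numCycles β′ + k                      ∎
    where open ≡-Reasoning
  tail-ok : NonCrossing (tail τ)
  tail-ok = nonCrossing-of-attained (tail τ) β′ (sorted-tail τ sorted) (shifts-tail τ β sorted head-ok shifts) attained′
  nonCrossing : NonCrossing τ
  nonCrossing 0F       (sucF m) _         = head-ok m
  nonCrossing (sucF l) (sucF m) (s<s l<m) = tail-ok l m l<m

longCycle-step : ∀ n (x : Fin n) → suc (toℕ x) ℕ.< n → toℕ (longCycle n ⟨$⟩ʳ x) ≡ suc (toℕ x)
longCycle-step (suc zero)    0F       (s<s ())
longCycle-step (suc (suc n)) 0F       _         = cong toℕ (transpose-left {suc (suc n)} 0F (sucF 0F))
longCycle-step (suc (suc n)) (sucF x) (s<s x+1<n) =
  trans (cong toℕ (transpose-other 0F (sucF 0F) (sucF y) (λ ()) (y≢0 ∘ Finₚ.suc-injective))) (cong suc ih)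
  where
  y = longCycle (suc n) ⟨$⟩ʳ x
  ih = longCycle-step (suc n) x x+1<n
  y≢0 : y ≢ 0F
  y≢0 y≡0 with trans (sym ih) (cong toℕ y≡0)
  ... | ()

longCycle-last : ∀ n (x : Fin (suc n)) → suc (toℕ x) ≡ suc n → longCycle (suc n) ⟨$⟩ʳ x ≡ 0F
longCycle-last zero    0F       refl = refl
longCycle-last (suc n) (sucF x) x+1≡n =
  trans (cong (λ z → PC.transpose 0F (sucF 0F) (sucF z)) (longCycle-last n x (ℕₚ.suc-injective x+1≡n)))
        (transpose-right 0F (sucF 0F))

-- every point climbs to the top and wraps around to 0
longCycle-to-zero : ∀ n (x : Fin (suc n)) → SameCycle (longCycle (suc n)) x 0F
longCycle-to-zero n x = suc (n ∸ toℕ x) , longCycle-last n _ (cong suc (trans climbed x+d≡n))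
  where
  x+d≡n : toℕ x + (n ∸ toℕ x) ≡ n
  x+d≡n = ℕₚ.m+[n∸m]≡n (ℕ.s≤s⁻¹ (Finₚ.toℕ<n x))
  climbed = climb (longCycle (suc n)) x (n ∸ toℕ x)
    (λ y _ y<n → longCycle-step (suc n) y (s<s (subst (toℕ y ℕ.<_) x+d≡n y<n)))

numCycles-longCycle : ∀ n → numCycles (longCycle (suc n)) ≡ 1
numCycles-longCycle n = trans (numCycles-classCount c) (count-only-zero (λ x → does (isLeast? (sameCycle? c) x))
  (dec-true (isLeast? (sameCycle? c) 0F) (λ y _ → z≤n))
  (λ x → dec-false (isLeast? (sameCycle? c) (sucF x)) (λ least → 1+x≰0 (least 0F (longCycle-to-zero n (sucF x))))))
  where
  c = longCycle (suc n)
  1+x≰0 : ∀ {x} → ¬ (suc x ℕ.≤ 0)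
  1+x≰0 ()

-- the long cycle shifts every interval, since intervals stop below n - 1
longCycle-shifts : ∀ {n k} (τ : Fin k → Transposition n) → Shifts (longCycle n) τ
longCycle-shifts {n} τ l x (_ , x<j) = longCycle-step n x (ℕₚ.≤-<-trans x<j (Finₚ.toℕ<n (j (τ l))))

-- The arithmetic turning membership in Σ into two cycle counts, for
-- n + 1 points, a product with a cycles and a complement with b cycles.
counts-arithmetic : ∀ n k a b → 1 ℕ.≤ a → a ℕ.≤ suc n → b ℕ.≤ suc n →
  (suc n ∸ a ≡ k × n ≡ (suc n ∸ a) + (suc n ∸ b)) ⇔ (a + k ≡ suc n × b ≡ suc k)
counts-arithmetic n k a b 1≤a a≤n b≤n = mk⇔ to from
  where
  to : suc n ∸ a ≡ k × n ≡ (suc n ∸ a) + (suc n ∸ b) → a + k ≡ suc n × b ≡ suc k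
  to (n-a≡k , n≡sum) = trans (cong (a +_) (sym n-a≡k)) (ℕₚ.m+[n∸m]≡n a≤n) ,
    ℕₚ.+-cancelʳ-≡ (suc n ∸ b) b (suc k) (begin
      b + (suc n ∸ b)                  ≡⟨ ℕₚ.m+[n∸m]≡n b≤n ⟩
      suc n                            ≡⟨ cong suc n≡sum ⟩
      suc (suc n ∸ a) + (suc n ∸ b)    ≡⟨ cong (λ d → suc d + (suc n ∸ b)) n-a≡k ⟩
      suc k + (suc n ∸ b)              ∎)
    where open ≡-Reasoning
  from : a + k ≡ suc n × b ≡ suc k → suc n ∸ a ≡ k × n ≡ (suc n ∸ a) + (suc n ∸ b)
  from (a+k≡n , refl) = n-a≡k , sym (trans (cong (_+ (n ∸ k)) n-a≡k) (ℕₚ.m+[n∸m]≡n k≤n))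
    where
    n-a≡k = trans (cong (_∸ a) (sym a+k≡n)) (ℕₚ.m+n∸m≡n a k)
    k≤n : k ℕ.≤ n
    k≤n = ℕ.s≤s⁻¹ (ℕₚ.≤-trans (ℕₚ.+-monoˡ-≤ k 1≤a) (ℕₚ.≤-reflexive a+k≡n))

inΣ⇔counts : ∀ n k (τ : Fin k → Transposition (suc n)) →
  InΣ (suc n) k τ ⇔ (numCycles (prod τ) + k ≡ suc n × numCycles (prod τ ⁻¹ · longCycle (suc n)) ≡ suc k)
inΣ⇔counts n k τ rewrite numCycles-longCycle n =
  counts-arithmetic n k _ _ (numCycles-pos (prod τ)) (numCycles-≤ (prod τ))
                            (numCycles-≤ (prod τ ⁻¹ · longCycle (suc n)))

proposition3p5 : ∀ (n k : ℕ) (τ : Fin k → Transposition n)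
    → (∀ (l m : Fin k) → l ≤ m → i (τ l) ≤ i (τ m))
    → InΣ n k τ ⇔ (∀ (l m : Fin k) → l < m → j (τ l) ≤ i (τ m) ⊎ j (τ m) < j (τ l))
-- (with no points there are no transpositions, and both sides hold trivially)
proposition3p5 zero    zero    τ sorted = mk⇔ (λ _ ()) (λ _ → refl , refl)
proposition3p5 zero    (suc k) τ sorted with i (τ 0F)
... | ()
proposition3p5 (suc n) k τ sorted = mk⇔
  (λ inΣ → nonCrossing-of-attained τ c sorted shifts
             (trans (proj₂ (to inΣ)) (cong (_+ k) (sym (numCycles-longCycle n)))))
  (λ nc → from (numCycles-product τ sorted nc ,
                trans (numCycles-after τ c sorted nc shifts) (cong (_+ k) (numCycles-longCycle n))))
  where
  open Equivalence (inΣ⇔counts n k τ)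
  c = longCycle (suc n)
  shifts = longCycle-shifts τ
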